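{- Let $n\ge 3$, let $\mathbb{W}_{n}$ be the Web graph and let $P=\{p_i : 1\le i\le n\}$. If $M$ is any mixed metric generator of $\mathbb{W}_{n}$, then $P\cap M\ne\emptyset$.
   Context: For an integer $n\ge 3$, the Web graph $\mathbb{W}_{n}$ has vertex set $\{p_i,q_i,r_i : 1\le i\le n\}$ and edge set $\{p_iq_i,\ p_ip_{i+1},\ q_iq_{i+1},\ q_ir_i : 1\le i\le n\}$, with indices taken modulo $n$. For a connected graph $H$, $d_H(u,v)$ is the shortest-path distance, and for a vertex $x$ and an edge $e=uv$, $d_H(x,e)=\min\{d_H(x,u),d_H(x,v)\}$. A set $M\subseteq V(H)$ is a mixed metric generator of $H$ if for every two distinct elements $y_1,y_2\in V(H)\cup E(H)$ there is a vertex $z\in M$ with $d_H(z,y_1)\ne d_H(z,y_2)$. -}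

module Defs where

open import Data.Nat using (ℕ; zero; suc; _≤_; _⊓_)
open import Data.Nat.DivMod using (_mod_)
open import Data.Fin using (Fin; toℕ)
open import Data.Bool using (Bool; true)
open import Data.Product using (_×_; Σ; ∃; ∃-syntax; _,_)
open import Data.Sum using (_⊎_; inj₁; inj₂)
open import Relation.Binary.PropositionalEquality using (_≡_; _≢_)

-- index successor modulo n (indices are 0..n-1 here, i.e. i ↦ i+1 mod n)
next : ∀ {n} → Fin n → Fin n
next {suc m} i = suc (toℕ i) mod (suc m)

data VKind : Set where
  p q r : VKind

Vertex : ℕ → Set
Vertex n = VKind × Fin n

data EKind : Set where
  pq pp qq qr : EKind

Edge : ℕ → Set
Edge n = EKind × Fin n

ends : ∀ {n} → Edge n → Vertex n × Vertex n
ends (pq , i) = (p , i) , (q , i)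
ends (pp , i) = (p , i) , (p , next i)
ends (qq , i) = (q , i) , (q , next i)
ends (qr , i) = (q , i) , (r , i)

src tgt : ∀ {n} → Edge n → Vertex n
src e with ends e
... | u , _ = u
tgt e with ends e
... | _ , v = v

Adj : ∀ {n} → Vertex n → Vertex n → Set
Adj {n} u v = Σ (Edge n) λ e → (src e ≡ u × tgt e ≡ v) ⊎ (src e ≡ v × tgt e ≡ u)

data Walk {n : ℕ} : Vertex n → Vertex n → ℕ → Set where
  here : ∀ {u} → Walk u u zero
  step : ∀ {u v w k} → Adj u v → Walk v w k → Walk u w (suc k)

Dist : ∀ {n} → Vertex n → Vertex n → ℕ → Set
Dist u v k = Walk u v k × (∀ j → Walk u v j → k ≤ j)

Elem : ℕ → Set
Elem n = Vertex n ⊎ Edge n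

ElemDist : ∀ {n} → Vertex n → Elem n → ℕ → Set
ElemDist x (inj₁ v) k = Dist x v k
ElemDist x (inj₂ e) k = ∃[ a ] ∃[ b ] (Dist x (src e) a × Dist x (tgt e) b × k ≡ a ⊓ b)

Distinguishes : ∀ {n} → Vertex n → Elem n → Elem n → Set
Distinguishes z y₁ y₂ = ∀ k₁ k₂ → ElemDist z y₁ k₁ → ElemDist z y₂ k₂ → k₁ ≢ k₂

MixedMetricGenerator : ∀ {n} → (Vertex n → Bool) → Set
MixedMetricGenerator {n} M =
  (y₁ y₂ : Elem n) → y₁ ≢ y₂ → ∃[ z ] (M z ≡ true × Distinguishes z y₁ y₂)

{-# OPTIONS --safe #-}
module Submission where

-- A vertex z outside P is never closer to p_i than to q_i: contracting every spoke p_i q_i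
-- maps a walk from z to p_i onto a walk from z to q_i that is no longer.  Hence
-- d(z, p_i q_i) = min (d(z, p_i), d(z, q_i)) = d(z, q_i), so only a vertex of P can distinguish
-- the vertex q_0 from the edge p_0 q_0.

open import Defs
open import Data.Nat using (ℕ; zero; suc; _≤_; _<_; _⊓_; z≤n; s≤s)
open import Data.Nat.Properties using (≤-trans; n≤1+n; m≤n⇒m≤1+n; ≮⇒≥; m≥n⇒m⊓n≡n; anyUpTo?)
open import Data.Nat.DivMod using (_%_; m<n⇒m%n≡m)
open import Data.Nat.Induction using (<-rec)
open import Data.Fin using (Fin; toℕ; fromℕ<) renaming (zero to fzero; _≟_ to _≟ᶠ_)
open import Data.Fin.Properties using (any?; toℕ-injective; toℕ-fromℕ<; fromℕ<-toℕ; toℕ<n)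
open import Data.Bool using (Bool; true)
open import Data.Product using (∃; ∃-syntax; _×_; _,_)
open import Data.Product.Properties using (≡-dec)
open import Data.Sum using (_⊎_; inj₁; inj₂)
open import Data.Empty using (⊥-elim)
open import Relation.Nullary using (Dec; yes; no; ¬_; _×-dec_; _⊎-dec_; map′)
open import Relation.Binary.Definitions using (DecidableEquality)
open import Relation.Binary.PropositionalEquality using (_≡_; refl; sym; cong; subst; module ≡-Reasoning)

Least : (ℕ → Set) → Set
Least P = ∃[ k ] (P k × (∀ j → P j → k ≤ j))

least : {P : ℕ → Set} → (∀ j → Dec (P j)) → ∀ m → P m → Least P
least {P} P? = <-rec (λ m → P m → Least P) go
  where
  go : ∀ m → (∀ {n} → n < m → P n → Least P) → P m → Least P
  go m below Pm with anyUpTo? P? m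
  ... | yes (n , n<m , Pn) = below n<m Pn
  ... | no none-below      = m , Pm , λ j Pj → ≮⇒≥ λ j<m → none-below (j , j<m , Pj)

_≟ₖ_ : DecidableEquality VKind
p ≟ₖ p = yes refl
q ≟ₖ q = yes refl
r ≟ₖ r = yes refl
p ≟ₖ q = no λ ()
p ≟ₖ r = no λ ()
q ≟ₖ p = no λ ()
q ≟ₖ r = no λ ()
r ≟ₖ p = no λ ()
r ≟ₖ q = no λ ()

_≟ᵥ_ : ∀ {n} → DecidableEquality (Vertex n)
_≟ᵥ_ = ≡-dec _≟ₖ_ _≟ᶠ_

any-kind? : {P : EKind → Set} → (∀ k → Dec (P k)) → Dec (∃ P)
any-kind? {P} P? = map′ witness cases (P? pq ⊎-dec P? pp ⊎-dec P? qq ⊎-dec P? qr)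
  where
  witness : P pq ⊎ P pp ⊎ P qq ⊎ P qr → ∃ P
  witness (inj₁ x)               = pq , x
  witness (inj₂ (inj₁ x))        = pp , x
  witness (inj₂ (inj₂ (inj₁ x))) = qq , x
  witness (inj₂ (inj₂ (inj₂ x))) = qr , x
  cases : ∃ P → P pq ⊎ P pp ⊎ P qq ⊎ P qr
  cases (pq , x) = inj₁ x
  cases (pp , x) = inj₂ (inj₁ x)
  cases (qq , x) = inj₂ (inj₂ (inj₁ x))
  cases (qr , x) = inj₂ (inj₂ (inj₂ x))

any-edge? : ∀ {n} {P : Edge n → Set} → (∀ e → Dec (P e)) → Dec (∃ P)
any-edge? P? = map′ (λ (k , i , x) → (k , i) , x) (λ ((k , i) , x) → k , i , x)
                    (any-kind? λ k → any? λ i → P? (k , i))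

walk? : ∀ {n} j (u v : Vertex n) → Dec (Walk u v j)
walk? zero u v = map′ (λ { refl → here }) (λ { here → refl }) (u ≟ᵥ v)
walk? (suc j) u v = map′ first-step split
  (any-edge? λ e → (src e ≟ᵥ u ×-dec walk? j (tgt e) v) ⊎-dec (tgt e ≟ᵥ u ×-dec walk? j (src e) v))
  where
  FirstStep : Edge _ → Set
  FirstStep e = (src e ≡ u × Walk (tgt e) v j) ⊎ (tgt e ≡ u × Walk (src e) v j)
  first-step : ∃ FirstStep → Walk u v (suc j)
  first-step (e , inj₁ (refl , w)) = step (e , inj₁ (refl , refl)) w
  first-step (e , inj₂ (refl , w)) = step (e , inj₂ (refl , refl)) w
  split : Walk u v (suc j) → ∃ FirstStep
  split (step (e , inj₁ (refl , refl)) w) = e , inj₁ (refl , w)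
  split (step (e , inj₂ (refl , refl)) w) = e , inj₂ (refl , w)

dist-exists : ∀ {n} {u v : Vertex n} {j} → Walk u v j → ∃ (Dist u v)
dist-exists {u = u} {v} w = least (λ k → walk? k u v) _ w

snoc : ∀ {n} {u v w : Vertex n} {k} → Walk u v k → Adj v w → Walk u w (suc k)
snoc here           a = step a here
snoc (step a′ walk) a = step a′ (snoc walk a)

next-fromℕ< : ∀ {m k} (k<n : k < suc m) (k+1<n : suc k < suc m) → next (fromℕ< k<n) ≡ fromℕ< k+1<n
next-fromℕ< {m} {k} k<n k+1<n = toℕ-injective (begin
  toℕ (next (fromℕ< k<n))       ≡⟨ toℕ-fromℕ< _ ⟩
  suc (toℕ (fromℕ< k<n)) % suc m ≡⟨ cong (λ x → suc x % suc m) (toℕ-fromℕ< k<n) ⟩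
  suc k % suc m                  ≡⟨ m<n⇒m%n≡m k+1<n ⟩
  suc k                          ≡⟨ toℕ-fromℕ< k+1<n ⟨
  toℕ (fromℕ< k+1<n)             ∎)
  where open ≡-Reasoning

walk-along-q : ∀ {m} k (k<n : k < suc m) → Walk (q , fromℕ< k<n) (q , fzero) k
walk-along-q zero    _     = here
walk-along-q (suc k) k+1<n =
  step ((qq , fromℕ< k<n) , inj₂ (refl , cong (q ,_) (next-fromℕ< k<n k+1<n))) (walk-along-q k k<n)
  where
  k<n = ≤-trans (n≤1+n (suc k)) k+1<n

q-walk-to-q₀ : ∀ {m} (i : Fin (suc m)) → Walk (q , i) (q , fzero) (toℕ i)
q-walk-to-q₀ i = subst (λ j → Walk (q , j) (q , fzero) (toℕ i)) (fromℕ<-toℕ i (toℕ<n i))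
                       (walk-along-q (toℕ i) (toℕ<n i))

retract : ∀ {n} → Vertex n → Vertex n
retract (p , i) = q , i
retract (q , i) = q , i
retract (r , i) = r , i

retract-adj : ∀ {n} {u v : Vertex n} → Adj u v → retract u ≡ retract v ⊎ Adj (retract u) (retract v)
retract-adj ((pq , i) , inj₁ (refl , refl)) = inj₁ refl
retract-adj ((pq , i) , inj₂ (refl , refl)) = inj₁ refl
retract-adj ((pp , i) , inj₁ (refl , refl)) = inj₂ ((qq , i) , inj₁ (refl , refl))
retract-adj ((pp , i) , inj₂ (refl , refl)) = inj₂ ((qq , i) , inj₂ (refl , refl))
retract-adj ((qq , i) , inj₁ (refl , refl)) = inj₂ ((qq , i) , inj₁ (refl , refl))
retract-adj ((qq , i) , inj₂ (refl , refl)) = inj₂ ((qq , i) , inj₂ (refl , refl))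
retract-adj ((qr , i) , inj₁ (refl , refl)) = inj₂ ((qr , i) , inj₁ (refl , refl))
retract-adj ((qr , i) , inj₂ (refl , refl)) = inj₂ ((qr , i) , inj₂ (refl , refl))

retract-walk : ∀ {n} {u v : Vertex n} {k} → Walk u v k → ∃[ j ] (j ≤ k × Walk (retract u) (retract v) j)
retract-walk here = zero , z≤n , here
retract-walk (step a w) with retract-walk w | retract-adj a
... | j , j≤k , w′ | inj₁ same = j , m≤n⇒m≤1+n j≤k , subst (λ x → Walk x _ j) (sym same) w′
... | j , j≤k , w′ | inj₂ a′   = suc j , s≤s j≤k , step a′ w′

dist-q≤dist-p : ∀ {n} {z : Vertex n} {i a b} → retract z ≡ z →
                Dist z (q , i) a → Dist z (p , i) b → a ≤ b
dist-q≤dist-p fixed (_ , shortest) (to-p , _) with retract-walk to-p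
... | j , j≤b , w = ≤-trans (shortest j (subst (λ x → Walk x _ j) fixed w)) j≤b

q-and-spoke-indistinguishable : ∀ {n} {z : Vertex n} {i k} → retract z ≡ z → Walk z (q , i) k →
                                ¬ Distinguishes z (inj₁ (q , i)) (inj₂ (pq , i))
q-and-spoke-indistinguishable {i = i} fixed to-q apart
  with dist-exists to-q | dist-exists (snoc to-q ((pq , i) , inj₂ (refl , refl)))
... | a , dq | b , dp =
  apart a (b ⊓ a) dq (b , a , dp , dq , refl) (sym (m≥n⇒m⊓n≡n (dist-q≤dist-p fixed dq dp)))

lemma5 : (n : ℕ) → 3 ≤ n → (M : Vertex n → Bool) → MixedMetricGenerator M →
           ∃[ i ] (M (p , i) ≡ true)
-- Only n ≥ 1 is used, to have the index 0.
lemma5 (suc m) _ M generator with generator (inj₁ (q , fzero)) (inj₂ (pq , fzero)) (λ ())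
... | (p , i) , i∈M , _     = i , i∈M
... | (q , i) , _   , apart =
  ⊥-elim (q-and-spoke-indistinguishable refl (q-walk-to-q₀ i) apart)
... | (r , i) , _   , apart =
  ⊥-elim (q-and-spoke-indistinguishable refl (step ((qr , i) , inj₂ (refl , refl)) (q-walk-to-q₀ i)) apart)
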